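{- For every finite poset $P$ with non-empty ground set, $\operatorname{cw}(P)\leq |P|$, where $|P|$ denotes the number of elements of $P$.
   Context: For a finite poset $P$, a family $\mathcal{S}=(S_x:x\in P)$ of sets indexed by the elements of $P$ is an inclusion representation of $P$ if for all $x,y\in P$: $x\le y$ in $P$ if and only if $S_x\subseteq S_y$. The set $\bigcup\mathcal{S}=\bigcup_{x\in P}S_x$ is the ground set of $\mathcal{S}$. The cube height $\operatorname{ch}(P)$ is the least non-negative integer $h$ such that $P$ has an inclusion representation with $|S_x|\le h$ for every $x\in P$. The cube width $\operatorname{cw}(P)$ is the least non-negative integer $w$ such that there is an inclusion representation $\mathcal{S}$ of $P$ with $|\bigcup\mathcal{S}|=w$ and $|S_x|\le\operatorname{ch}(P)$ for every $x\in P$. -}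

module Defs where

open import Data.Nat using (ℕ; _≤_)
open import Data.Fin using (Fin)
open import Data.Fin.Subset using (Subset; _⊆_; _∈_; ∣_∣)
open import Data.Product using (Σ; ∃; _×_)
open import Function.Bundles using (_⇔_)
open import Relation.Binary.Structures using (IsPartialOrder)
open import Relation.Binary.PropositionalEquality using (_≡_)
open import Level using (0ℓ)

record FinPoset (n : ℕ) : Set₁ where
  field
    _≼_       : Fin n → Fin n → Set
    isPartialOrder : IsPartialOrder _≡_ _≼_

module _ {n : ℕ} (P : FinPoset n) where
  open FinPoset P

  IsInclusionRep : {m : ℕ} → (Fin n → Subset m) → Set
  IsInclusionRep S = ∀ x y → (x ≼ y) ⇔ (S x ⊆ S y)

  HeightAtMost : {m : ℕ} → (Fin n → Subset m) → ℕ → Set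
  HeightAtMost S h = ∀ x → ∣ S x ∣ ≤ h

  -- The union of the family is the whole of Fin m (so the ground set has size m).
  CoversGround : {m : ℕ} → (Fin n → Subset m) → Set
  CoversGround {m} S = ∀ (i : Fin m) → ∃ λ x → i ∈ S x

  HasRepOfHeight : ℕ → Set
  HasRepOfHeight h = Σ ℕ λ m → Σ (Fin n → Subset m) λ S → IsInclusionRep S × HeightAtMost S h

  IsCubeHeight : ℕ → Set
  IsCubeHeight h = HasRepOfHeight h × (∀ h′ → HasRepOfHeight h′ → h ≤ h′)

  HasRepOfWidth : ℕ → ℕ → Set
  HasRepOfWidth h w = Σ (Fin n → Subset w) λ S →
    IsInclusionRep S × CoversGround S × HeightAtMost S h

  IsCubeWidth : ℕ → ℕ → Set
  IsCubeWidth h w = HasRepOfWidth h w × (∀ w′ → HasRepOfWidth h w′ → w ≤ w′)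

-- Read an inclusion representation F of P on m points as the bipartite graph "i ∈ F y"
-- between points and elements of P. If m > |P|, the deficiency form of Hall's theorem
-- gives a set A of points and a set X of elements, containing every y with F y meeting A,
-- matched injectively into A by g with |X| < |A|. Replacing F x ∩ A by the matched points
-- g y of the y ∈ X with F y ⊆ F x enlarges no set and preserves all inclusions and
-- non-inclusions (if F x meets A then x ∈ X and g x is the witness), and it leaves a point
-- of A outside g[X] unused. Deleting unused points brings every representation down to at
-- most |P| points, so a representation of minimum width has at most |P| points.

module Submission where

open import Defs

open import Data.Bool using (true)
open import Data.Bool.Properties using (T-≡)
open import Data.Fin as Fin using (Fin; punchIn; punchOut)
open import Data.Fin.Properties using (punchIn-punchOut; any?; all?)
open import Data.Fin.Subset
open import Data.Fin.Subset.Induction using (⊂-wellFounded; Acc; acc)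
open import Data.Fin.Subset.Properties
open import Data.Nat using (ℕ; zero; suc; _+_; _≤_; _<_; z≤n; s≤s; NonZero)
open import Data.Nat.Properties
open import Data.Product using (Σ; ∃; _×_; _,_)
open import Data.Sum using (_⊎_; inj₁; inj₂)
open import Data.Vec using ([]; _∷_; here; there; lookup; removeAt; tabulate)
open import Data.Vec.Properties using ([]=⇒lookup; lookup⇒[]=; lookup∘tabulate)
open import Function using (_∘_; id)
open import Function.Bundles using (Equivalence; _⇔_; mk⇔)
open import Function.Properties.Equivalence using () renaming (refl to ⇔-refl; trans to ⇔-trans)
open import Level using (Level)
open import Relation.Binary.PropositionalEquality
open import Relation.Nullary using (¬_; Dec; isYes; yes; no; contradiction; ¬?)
open import Relation.Nullary.Decidable using (toWitness; fromWitness; _×-dec_)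
open import Relation.Unary using (Pred; Decidable)

private variable
  m m′ n : ℕ
  ℓ : Level

-- Subsets of Fin n

∣p∪q∣+∣p∩q∣≡∣p∣+∣q∣ : ∀ (p q : Subset n) → ∣ p ∪ q ∣ + ∣ p ∩ q ∣ ≡ ∣ p ∣ + ∣ q ∣
∣p∪q∣+∣p∩q∣≡∣p∣+∣q∣ []            []            = refl
∣p∪q∣+∣p∩q∣≡∣p∣+∣q∣ (inside  ∷ p) (inside  ∷ q)
  rewrite +-suc ∣ p ∪ q ∣ ∣ p ∩ q ∣ | +-suc ∣ p ∣ ∣ q ∣ = cong (suc ∘ suc) (∣p∪q∣+∣p∩q∣≡∣p∣+∣q∣ p q)
∣p∪q∣+∣p∩q∣≡∣p∣+∣q∣ (inside  ∷ p) (outside ∷ q) = cong suc (∣p∪q∣+∣p∩q∣≡∣p∣+∣q∣ p q)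
∣p∪q∣+∣p∩q∣≡∣p∣+∣q∣ (outside ∷ p) (inside  ∷ q)
  rewrite +-suc ∣ p ∣ ∣ q ∣ = cong suc (∣p∪q∣+∣p∩q∣≡∣p∣+∣q∣ p q)
∣p∪q∣+∣p∩q∣≡∣p∣+∣q∣ (outside ∷ p) (outside ∷ q) = ∣p∪q∣+∣p∩q∣≡∣p∣+∣q∣ p q

∣p∪q∣≤∣p∣+∣q∣ : ∀ (p q : Subset n) → ∣ p ∪ q ∣ ≤ ∣ p ∣ + ∣ q ∣
∣p∪q∣≤∣p∣+∣q∣ p q = ≤-trans (m≤m+n _ _) (≤-reflexive (∣p∪q∣+∣p∩q∣≡∣p∣+∣q∣ p q))

∣p∣≡∣p∩q∣+∣p─q∣ : ∀ (p q : Subset n) → ∣ p ∣ ≡ ∣ p ∩ q ∣ + ∣ p ─ q ∣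
∣p∣≡∣p∩q∣+∣p─q∣ []            []            = refl
∣p∣≡∣p∩q∣+∣p─q∣ (inside  ∷ p) (inside  ∷ q) = cong suc (∣p∣≡∣p∩q∣+∣p─q∣ p q)
∣p∣≡∣p∩q∣+∣p─q∣ (inside  ∷ p) (outside ∷ q) =
  trans (cong suc (∣p∣≡∣p∩q∣+∣p─q∣ p q)) (sym (+-suc _ _))
∣p∣≡∣p∩q∣+∣p─q∣ (outside ∷ p) (inside  ∷ q) = ∣p∣≡∣p∩q∣+∣p─q∣ p q
∣p∣≡∣p∩q∣+∣p─q∣ (outside ∷ p) (outside ∷ q) = ∣p∣≡∣p∩q∣+∣p─q∣ p q

Empty⇒∣p∣≡0 : {p : Subset n} → Empty p → ∣ p ∣ ≡ 0
Empty⇒∣p∣≡0 {n} p-empty = trans (cong ∣_∣ (Empty-unique p-empty)) (∣⊥∣≡0 n)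

0<∣p∣⇒Nonempty : {p : Subset n} → 0 < ∣ p ∣ → Nonempty p
0<∣p∣⇒Nonempty {p = p} 0<∣p∣ with nonempty? p
... | yes p-nonempty = p-nonempty
... | no  p-empty    = contradiction (subst (0 <_) (Empty⇒∣p∣≡0 p-empty) 0<∣p∣) λ ()

x∈p─q⇒x∉q : {p q : Subset n} {x : Fin n} → x ∈ p ─ q → x ∉ q
x∈p─q⇒x∉q {p = _ ∷ _} {q = outside ∷ _} (there x∈p─q) (there x∈q) = x∈p─q⇒x∉q x∈p─q x∈q
x∈p─q⇒x∉q {p = _ ∷ _} {q = inside  ∷ _} (there x∈p─q) (there x∈q) = x∈p─q⇒x∉q x∈p─q x∈q

∣q∣<∣p∣⇒Nonempty[p─q] : ∀ (p q : Subset n) → ∣ q ∣ < ∣ p ∣ → Nonempty (p ─ q)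
∣q∣<∣p∣⇒Nonempty[p─q] p q ∣q∣<∣p∣ = 0<∣p∣⇒Nonempty (+-cancelˡ-< ∣ q ∣ 0 _ (begin-strict
  ∣ q ∣ + 0              ≡⟨ +-identityʳ _ ⟩
  ∣ q ∣                  <⟨ ∣q∣<∣p∣ ⟩
  ∣ p ∣                  ≡⟨ ∣p∣≡∣p∩q∣+∣p─q∣ p q ⟩
  ∣ p ∩ q ∣ + ∣ p ─ q ∣  ≤⟨ +-monoˡ-≤ _ (∣p∩q∣≤∣q∣ p q) ⟩
  ∣ q ∣ + ∣ p ─ q ∣      ∎))
  where open ≤-Reasoning

⊆∧Nonempty⇒p─q⊂p : {p q : Subset n} → q ⊆ p → Nonempty q → p ─ q ⊂ p
⊆∧Nonempty⇒p─q⊂p {p = p} {q} q⊆p (x , x∈q) = p∩q≢∅⇒p─q⊂p p q (x , x∈p∩q⁺ (q⊆p x∈q , x∈q))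

∣p∪q∣≡∣p∣+∣q∣ : ∀ (p q : Subset n) → Empty (p ∩ q) → ∣ p ∪ q ∣ ≡ ∣ p ∣ + ∣ q ∣
∣p∪q∣≡∣p∣+∣q∣ p q disjoint = begin
  ∣ p ∪ q ∣              ≡⟨ +-identityʳ _ ⟨
  ∣ p ∪ q ∣ + 0          ≡⟨ cong (∣ p ∪ q ∣ +_) (Empty⇒∣p∣≡0 disjoint) ⟨
  ∣ p ∪ q ∣ + ∣ p ∩ q ∣  ≡⟨ ∣p∪q∣+∣p∩q∣≡∣p∣+∣q∣ p q ⟩
  ∣ p ∣ + ∣ q ∣          ∎
  where open ≡-Reasoning

⋃ᶠ : Subset n → (Fin n → Subset m) → Subset m
⋃ᶠ []            N = ⊥
⋃ᶠ (inside  ∷ Z) N = N Fin.zero ∪ ⋃ᶠ Z (N ∘ Fin.suc)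
⋃ᶠ (outside ∷ Z) N = ⋃ᶠ Z (N ∘ Fin.suc)

syntax ⋃ᶠ Z (λ y → N) = ⋃[ y ∈ Z ] N

x∈⋃⁺ : ∀ (N : Fin n → Subset m) {Z y x} → y ∈ Z → x ∈ N y → x ∈ ⋃ᶠ Z N
x∈⋃⁺ N {inside  ∷ Z} here        x∈Ny = x∈p∪q⁺ (inj₁ x∈Ny)
x∈⋃⁺ N {inside  ∷ Z} (there y∈Z) x∈Ny = x∈p∪q⁺ (inj₂ (x∈⋃⁺ (N ∘ Fin.suc) y∈Z x∈Ny))
x∈⋃⁺ N {outside ∷ Z} (there y∈Z) x∈Ny = x∈⋃⁺ (N ∘ Fin.suc) y∈Z x∈Ny

x∈⋃⁻ : ∀ (N : Fin n → Subset m) {Z x} → x ∈ ⋃ᶠ Z N → ∃ λ y → y ∈ Z × x ∈ N y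
x∈⋃⁻ N {[]}          x∈⊥ = contradiction x∈⊥ ∉⊥
x∈⋃⁻ N {inside  ∷ Z} x∈⋃ with x∈p∪q⁻ (N Fin.zero) _ x∈⋃
... | inj₁ x∈N₀ = Fin.zero , here , x∈N₀
... | inj₂ x∈⋃′ with x∈⋃⁻ (N ∘ Fin.suc) x∈⋃′
...   | y , y∈Z , x∈Ny = Fin.suc y , there y∈Z , x∈Ny
x∈⋃⁻ N {outside ∷ Z} x∈⋃ with x∈⋃⁻ (N ∘ Fin.suc) x∈⋃
... | y , y∈Z , x∈Ny = Fin.suc y , there y∈Z , x∈Ny

∣⋃∣≤∣Z∣ : ∀ (N : Fin n → Subset m) Z → (∀ y → ∣ N y ∣ ≤ 1) → ∣ ⋃ᶠ Z N ∣ ≤ ∣ Z ∣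
∣⋃∣≤∣Z∣ {m = m} N []      _       = ≤-reflexive (∣⊥∣≡0 m)
∣⋃∣≤∣Z∣ N (inside  ∷ Z) ∣N∣≤1 = ≤-trans (∣p∪q∣≤∣p∣+∣q∣ (N Fin.zero) _)
  (+-mono-≤ (∣N∣≤1 Fin.zero) (∣⋃∣≤∣Z∣ (N ∘ Fin.suc) Z (∣N∣≤1 ∘ Fin.suc)))
∣⋃∣≤∣Z∣ N (outside ∷ Z) ∣N∣≤1 = ∣⋃∣≤∣Z∣ (N ∘ Fin.suc) Z (∣N∣≤1 ∘ Fin.suc)

select : {P : Pred (Fin n) ℓ} → Decidable P → Subset n
select P? = tabulate (isYes ∘ P?)

x∈select⁺ : {P : Pred (Fin n) ℓ} (P? : Decidable P) {x : Fin n} → P x → x ∈ select P?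
x∈select⁺ P? {x} Px = lookup⇒[]= x _ (begin
  lookup (select P?) x  ≡⟨ lookup∘tabulate (isYes ∘ P?) x ⟩
  isYes (P? x)          ≡⟨ Equivalence.to T-≡ (fromWitness Px) ⟩
  true                  ∎)
  where open ≡-Reasoning

x∈select⁻ : {P : Pred (Fin n) ℓ} (P? : Decidable P) {x : Fin n} → x ∈ select P? → P x
x∈select⁻ P? {x} x∈ = toWitness (Equivalence.from T-≡ (begin
  isYes (P? x)          ≡⟨ lookup∘tabulate (isYes ∘ P?) x ⟨
  lookup (select P?) x  ≡⟨ []=⇒lookup x∈ ⟩
  true                  ∎))
  where open ≡-Reasoning

x∈removeAt⁺ : ∀ (p : Subset (suc n)) j {i} → punchIn j i ∈ p → i ∈ removeAt p j
x∈removeAt⁺ (_ ∷ _)         Fin.zero                (there i∈p) = i∈p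
x∈removeAt⁺ (_ ∷ _ ∷ _)     (Fin.suc j) {Fin.zero}   here        = here
x∈removeAt⁺ (_ ∷ p@(_ ∷ _)) (Fin.suc j) {Fin.suc i} (there i∈p) = there (x∈removeAt⁺ p j i∈p)

x∈removeAt⁻ : ∀ (p : Subset (suc n)) j {i} → i ∈ removeAt p j → punchIn j i ∈ p
x∈removeAt⁻ (_ ∷ _)         Fin.zero                i∈p = there i∈p
x∈removeAt⁻ (_ ∷ _ ∷ _)     (Fin.suc j) {Fin.zero}   here        = here
x∈removeAt⁻ (_ ∷ p@(_ ∷ _)) (Fin.suc j) {Fin.suc i} (there i∈p) = there (x∈removeAt⁻ p j i∈p)

∣removeAt∣≤∣p∣ : ∀ (p : Subset (suc n)) j → ∣ removeAt p j ∣ ≤ ∣ p ∣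
∣removeAt∣≤∣p∣ (s ∷ p)               Fin.zero    = ∣p∣≤∣x∷p∣ s p
∣removeAt∣≤∣p∣ (inside  ∷ p@(_ ∷ _)) (Fin.suc j) = s≤s (∣removeAt∣≤∣p∣ p j)
∣removeAt∣≤∣p∣ (outside ∷ p@(_ ∷ _)) (Fin.suc j) = ∣removeAt∣≤∣p∣ p j

p⊆q⇔removeAt⊆removeAt : ∀ {p q : Subset (suc n)} j → j ∉ p → p ⊆ q ⇔ removeAt p j ⊆ removeAt q j
p⊆q⇔removeAt⊆removeAt {p = p} {q} j j∉p = mk⇔ restrict extend
  where
  restrict : p ⊆ q → removeAt p j ⊆ removeAt q j
  restrict p⊆q = x∈removeAt⁺ q j ∘ p⊆q ∘ x∈removeAt⁻ p j

  extend : removeAt p j ⊆ removeAt q j → p ⊆ q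
  extend p′⊆q′ {k} k∈p =
    subst (_∈ q) k′≡k (x∈removeAt⁻ q j (p′⊆q′ (x∈removeAt⁺ p j (subst (_∈ p) (sym k′≡k) k∈p))))
    where
    j≢k : j ≢ k
    j≢k refl = j∉p k∈p

    k′≡k : punchIn j (punchOut j≢k) ≡ k
    k′≡k = punchIn-punchOut j≢k

-- Hall's theorem and its deficiency form

record Matching (N : Fin n → Subset m) (U : Subset m) (Y : Subset n) : Set where
  field
    match     : Fin n → Fin m
    match∈U   : ∀ {y} → y ∈ Y → match y ∈ U
    match∈N   : ∀ {y} → y ∈ Y → match y ∈ N y
    injective : ∀ {y y′} → y ∈ Y → y′ ∈ Y → match y ≡ match y′ → y ≡ y′

record Critical (N : Fin n → Subset m) (U : Subset m) (Y : Subset n) : Set where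
  field
    A        : Subset m
    X        : Subset n
    A⊆U      : A ⊆ U
    closed   : ∀ {i y} → i ∈ A → y ∈ Y → i ∈ N y → y ∈ X
    matching : Matching N A X
    ∣X∣<∣A∣  : ∣ X ∣ < ∣ A ∣

-- Matchings are total functions; i₀ is their junk value off Y, needed when Y is empty.
module Hall (N : Fin n → Subset m) (i₀ : Fin m) where

  Γ : Subset n → Subset m
  Γ Z = ⋃[ y ∈ Z ] N y

  record Violator (U : Subset m) (Y : Subset n) : Set where
    constructor violator
    field
      Z         : Subset n
      Z⊆Y       : Z ⊆ Y
      deficient : ∣ U ∩ Γ Z ∣ < ∣ Z ∣

  Γ-mono : {Z Z′ : Subset n} → Z ⊆ Z′ → Γ Z ⊆ Γ Z′
  Γ-mono Z⊆Z′ i∈ΓZ with x∈⋃⁻ N i∈ΓZ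
  ... | y , y∈Z , i∈Ny = x∈⋃⁺ N (Z⊆Z′ y∈Z) i∈Ny

  matching-∅ : {U : Subset m} {Y : Subset n} → Empty Y → Matching N U Y
  matching-∅ Y-empty = record
    { match     = λ _ → i₀
    ; match∈U   = λ y∈Y → contradiction (_ , y∈Y) Y-empty
    ; match∈N   = λ y∈Y → contradiction (_ , y∈Y) Y-empty
    ; injective = λ y∈Y _ _ → contradiction (_ , y∈Y) Y-empty
    }

  matching-join : ∀ {U Y} W Z → Matching N (U ∩ W) Z → Matching N (U ─ W) (Y ─ Z) → Matching N U Y
  matching-join {U} {Y} W Z M₁ M₂ = record
    { match = match ; match∈U = match∈U ; match∈N = match∈N ; injective = injective }
    where
    module M₁ = Matching M₁
    module M₂ = Matching M₂

    match : Fin n → Fin m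
    match y with y ∈? Z
    ... | yes _ = M₁.match y
    ... | no  _ = M₂.match y

    match∈U : ∀ {y} → y ∈ Y → match y ∈ U
    match∈U {y} y∈Y with y ∈? Z
    ... | yes y∈Z = p∩q⊆p U W (M₁.match∈U y∈Z)
    ... | no  y∉Z = p─q⊆p U W (M₂.match∈U (x∈p∧x∉q⇒x∈p─q y∈Y y∉Z))

    match∈N : ∀ {y} → y ∈ Y → match y ∈ N y
    match∈N {y} y∈Y with y ∈? Z
    ... | yes y∈Z = M₁.match∈N y∈Z
    ... | no  y∉Z = M₂.match∈N (x∈p∧x∉q⇒x∈p─q y∈Y y∉Z)

    separated : ∀ {y y′} → y ∈ Z → y′ ∈ Y ─ Z → M₁.match y ≢ M₂.match y′
    separated y∈Z y′∈Y─Z eq =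
      x∈p─q⇒x∉q (M₂.match∈U y′∈Y─Z) (subst (_∈ W) eq (p∩q⊆q U W (M₁.match∈U y∈Z)))

    injective : ∀ {y y′} → y ∈ Y → y′ ∈ Y → match y ≡ match y′ → y ≡ y′
    injective {y} {y′} y∈Y y′∈Y with y ∈? Z | y′ ∈? Z
    ... | yes y∈Z | yes y′∈Z = M₁.injective y∈Z y′∈Z
    ... | yes y∈Z | no  y′∉Z = λ eq → contradiction eq (separated y∈Z (x∈p∧x∉q⇒x∈p─q y′∈Y y′∉Z))
    ... | no  y∉Z | yes y′∈Z = λ eq → contradiction (sym eq) (separated y′∈Z (x∈p∧x∉q⇒x∈p─q y∈Y y∉Z))
    ... | no  y∉Z | no  y′∉Z = M₂.injective (x∈p∧x∉q⇒x∈p─q y∈Y y∉Z) (x∈p∧x∉q⇒x∈p─q y′∈Y y′∉Z)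

  matching-extend : ∀ {U Y y₀ c} → c ∈ U → c ∈ N y₀ → Matching N (U - c) (Y - y₀) → Matching N U Y
  matching-extend {U} {Y} {y₀} {c} c∈U c∈Ny₀ M = record
    { match = match ; match∈U = match∈U ; match∈N = match∈N ; injective = injective }
    where
    module M = Matching M

    match : Fin n → Fin m
    match y with y Fin.≟ y₀
    ... | yes _ = c
    ... | no  _ = M.match y

    match∈U : ∀ {y} → y ∈ Y → match y ∈ U
    match∈U {y} y∈Y with y Fin.≟ y₀
    ... | yes _    = c∈U
    ... | no  y≢y₀ = p─q⊆p U ⁅ c ⁆ (M.match∈U (x∈p∧x≢y⇒x∈p-y y∈Y y≢y₀))

    match∈N : ∀ {y} → y ∈ Y → match y ∈ N y
    match∈N {y} y∈Y with y Fin.≟ y₀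
    ... | yes refl = c∈Ny₀
    ... | no  y≢y₀ = M.match∈N (x∈p∧x≢y⇒x∈p-y y∈Y y≢y₀)

    match≢c : ∀ {y} → y ∈ Y → y ≢ y₀ → M.match y ≢ c
    match≢c y∈Y y≢y₀ eq =
      x∈p─q⇒x∉q (M.match∈U (x∈p∧x≢y⇒x∈p-y y∈Y y≢y₀)) (subst (_∈ ⁅ c ⁆) (sym eq) (x∈⁅x⁆ c))

    injective : ∀ {y y′} → y ∈ Y → y′ ∈ Y → match y ≡ match y′ → y ≡ y′
    injective {y} {y′} y∈Y y′∈Y with y Fin.≟ y₀ | y′ Fin.≟ y₀
    ... | yes y≡y₀ | yes y′≡y₀ = λ _ → trans y≡y₀ (sym y′≡y₀)
    ... | yes _    | no  y′≢y₀ = λ eq → contradiction (sym eq) (match≢c y′∈Y y′≢y₀)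
    ... | no  y≢y₀ | yes _     = λ eq → contradiction eq (match≢c y∈Y y≢y₀)
    ... | no  y≢y₀ | no  y′≢y₀ = M.injective (x∈p∧x≢y⇒x∈p-y y∈Y y≢y₀) (x∈p∧x≢y⇒x∈p-y y′∈Y y′≢y₀)

  violator-restrict : ∀ {U Y Z} → Z ⊆ Y → Violator (U ∩ Γ Z) Z → Violator U Y
  violator-restrict {U} {Y} {Z} Z⊆Y (violator Z′ Z′⊆Z deficient) =
    violator Z′ (Z⊆Y ∘ Z′⊆Z) (≤-<-trans (p⊆q⇒∣p∣≤∣q∣ U∩ΓZ′⊆) deficient)
    where
    U∩ΓZ′⊆ : U ∩ Γ Z′ ⊆ (U ∩ Γ Z) ∩ Γ Z′
    U∩ΓZ′⊆ i∈ with x∈p∩q⁻ U (Γ Z′) i∈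
    ... | i∈U , i∈ΓZ′ = x∈p∩q⁺ (x∈p∩q⁺ (i∈U , Γ-mono Z′⊆Z i∈ΓZ′) , i∈ΓZ′)

  violator-extend : ∀ {U Y Z} → Z ⊆ Y → ∣ U ∩ Γ Z ∣ ≤ ∣ Z ∣ → Violator (U ─ Γ Z) (Y ─ Z) → Violator U Y
  violator-extend {U} {Y} {Z} Z⊆Y ∣U∩ΓZ∣≤∣Z∣ (violator Z″ Z″⊆Y─Z deficient) =
    violator (Z ∪ Z″) Z∪Z″⊆Y (begin-strict
      ∣ U ∩ Γ (Z ∪ Z″) ∣                          ≤⟨ p⊆q⇒∣p∣≤∣q∣ U∩Γ[Z∪Z″]⊆ ⟩
      ∣ (U ∩ Γ Z) ∪ ((U ─ Γ Z) ∩ Γ Z″) ∣          ≤⟨ ∣p∪q∣≤∣p∣+∣q∣ (U ∩ Γ Z) _ ⟩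
      ∣ U ∩ Γ Z ∣ + ∣ (U ─ Γ Z) ∩ Γ Z″ ∣          <⟨ +-mono-≤-< ∣U∩ΓZ∣≤∣Z∣ deficient ⟩
      ∣ Z ∣ + ∣ Z″ ∣                              ≡⟨ ∣p∪q∣≡∣p∣+∣q∣ Z Z″ disjoint ⟨
      ∣ Z ∪ Z″ ∣                                  ∎)
    where
    open ≤-Reasoning

    Z∪Z″⊆Y : Z ∪ Z″ ⊆ Y
    Z∪Z″⊆Y y∈ with x∈p∪q⁻ Z Z″ y∈
    ... | inj₁ y∈Z  = Z⊆Y y∈Z
    ... | inj₂ y∈Z″ = p─q⊆p Y Z (Z″⊆Y─Z y∈Z″)

    disjoint : Empty (Z ∩ Z″)
    disjoint (y , y∈) with x∈p∩q⁻ Z Z″ y∈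
    ... | y∈Z , y∈Z″ = x∈p─q⇒x∉q (Z″⊆Y─Z y∈Z″) y∈Z

    U∩Γ[Z∪Z″]⊆ : U ∩ Γ (Z ∪ Z″) ⊆ (U ∩ Γ Z) ∪ ((U ─ Γ Z) ∩ Γ Z″)
    U∩Γ[Z∪Z″]⊆ {i} i∈ with x∈p∩q⁻ U (Γ (Z ∪ Z″)) i∈ | i ∈? Γ Z
    ... | i∈U , _      | yes i∈ΓZ = x∈p∪q⁺ (inj₁ (x∈p∩q⁺ (i∈U , i∈ΓZ)))
    ... | i∈U , i∈ΓZZ″ | no  i∉ΓZ with x∈⋃⁻ N i∈ΓZZ″
    ...   | y , y∈Z∪Z″ , i∈Ny with x∈p∪q⁻ Z Z″ y∈Z∪Z″
    ...     | inj₁ y∈Z  = contradiction (x∈⋃⁺ N y∈Z i∈Ny) i∉ΓZ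
    ...     | inj₂ y∈Z″ = x∈p∪q⁺ (inj₂ (x∈p∩q⁺ (x∈p∧x∉q⇒x∈p─q i∈U i∉ΓZ , x∈⋃⁺ N y∈Z″ i∈Ny)))

  violator-isolated : ∀ {U Y y₀} → y₀ ∈ Y → Empty (U ∩ N y₀) → Violator U Y
  violator-isolated {U} {Y} {y₀} y₀∈Y isolated =
    violator ⁅ y₀ ⁆ ⁅y₀⁆⊆Y (subst₂ _<_ (sym (Empty⇒∣p∣≡0 no-neighbour)) (sym (∣⁅x⁆∣≡1 y₀)) (s≤s z≤n))
    where
    ⁅y₀⁆⊆Y : ⁅ y₀ ⁆ ⊆ Y
    ⁅y₀⁆⊆Y y∈ = subst (_∈ Y) (sym (x∈⁅y⁆⇒x≡y y₀ y∈)) y₀∈Y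

    no-neighbour : Empty (U ∩ Γ ⁅ y₀ ⁆)
    no-neighbour (i , i∈) with x∈p∩q⁻ U (Γ ⁅ y₀ ⁆) i∈
    ... | i∈U , i∈Γ with x∈⋃⁻ N i∈Γ
    ...   | y , y∈⁅y₀⁆ , i∈Ny =
      isolated (i , x∈p∩q⁺ (i∈U , subst (λ z → i ∈ N z) (x∈⁅y⁆⇒x≡y y₀ y∈⁅y₀⁆) i∈Ny))

  Tight : Subset m → Subset n → Subset n → Set
  Tight U Y Z = Z ⊂ Y × Nonempty Z × ∣ U ∩ Γ Z ∣ ≤ ∣ Z ∣

  tight? : ∀ U Y → Decidable (Tight U Y)
  tight? U Y Z = Z ⊂? Y ×-dec nonempty? Z ×-dec ∣ U ∩ Γ Z ∣ ≤? ∣ Z ∣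

  violator⇒tight : ∀ {U Y y₀ c} → y₀ ∈ Y → Violator (U - c) (Y - y₀) → ∃ (Tight U Y)
  violator⇒tight {U} {Y} {y₀} {c} y₀∈Y (violator Z Z⊆Y-y₀ deficient) =
    Z , ⊆-⊂-trans Z⊆Y-y₀ (x∈p⇒p-x⊂p y₀∈Y) , 0<∣p∣⇒Nonempty (≤-<-trans z≤n deficient) , (begin
      ∣ U ∩ Γ Z ∣                      ≤⟨ p⊆q⇒∣p∣≤∣q∣ U∩ΓZ⊆ ⟩
      ∣ ((U - c) ∩ Γ Z) ∪ ⁅ c ⁆ ∣      ≤⟨ ∣p∪q∣≤∣p∣+∣q∣ ((U - c) ∩ Γ Z) _ ⟩
      ∣ (U - c) ∩ Γ Z ∣ + ∣ ⁅ c ⁆ ∣    ≡⟨ cong (∣ (U - c) ∩ Γ Z ∣ +_) (∣⁅x⁆∣≡1 c) ⟩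
      ∣ (U - c) ∩ Γ Z ∣ + 1            ≡⟨ +-comm _ 1 ⟩
      suc ∣ (U - c) ∩ Γ Z ∣            ≤⟨ deficient ⟩
      ∣ Z ∣                            ∎)
    where
    open ≤-Reasoning

    U∩ΓZ⊆ : U ∩ Γ Z ⊆ ((U - c) ∩ Γ Z) ∪ ⁅ c ⁆
    U∩ΓZ⊆ {i} i∈ with x∈p∩q⁻ U (Γ Z) i∈ | i Fin.≟ c
    ... | _          | yes refl = x∈p∪q⁺ (inj₂ (x∈⁅x⁆ c))
    ... | i∈U , i∈ΓZ | no  i≢c  = x∈p∪q⁺ (inj₁ (x∈p∩q⁺ (x∈p∧x≢y⇒x∈p-y i∈U i≢c , i∈ΓZ)))

  -- Halmos–Vaughan: split along a nonempty proper Z ⊂ Y that does not expand; if there is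
  -- none, every such Z has surplus, so matching y₀ to any neighbour c keeps Hall's condition.
  hall : ∀ U Y → Matching N U Y ⊎ Violator U Y
  hall U Y = go U Y (⊂-wellFounded Y)
    where
    go : ∀ U Y → Acc _⊂_ Y → Matching N U Y ⊎ Violator U Y
    go U Y (acc rec) with nonempty? Y
    ... | no Y-empty = inj₁ (matching-∅ Y-empty)
    ... | yes (y₀ , y₀∈Y) with anySubset? (tight? U Y)
    ...   | yes (Z , Z⊂Y@(Z⊆Y , _) , Z-nonempty , ∣U∩ΓZ∣≤∣Z∣)
      with go (U ∩ Γ Z) Z (rec Z⊂Y) | go (U ─ Γ Z) (Y ─ Z) (rec (⊆∧Nonempty⇒p─q⊂p Z⊆Y Z-nonempty))
    ...     | inj₂ V  | _       = inj₂ (violator-restrict Z⊆Y V)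
    ...     | inj₁ _  | inj₂ V  = inj₂ (violator-extend Z⊆Y ∣U∩ΓZ∣≤∣Z∣ V)
    ...     | inj₁ M₁ | inj₁ M₂ = inj₁ (matching-join (Γ Z) Z M₁ M₂)
    go U Y (acc rec) | yes (y₀ , y₀∈Y) | no no-tight with nonempty? (U ∩ N y₀)
    ...   | no isolated = inj₂ (violator-isolated y₀∈Y isolated)
    ...   | yes (c , c∈U∩Ny₀) with x∈p∩q⁻ U (N y₀) c∈U∩Ny₀ | go (U - c) (Y - y₀) (rec (x∈p⇒p-x⊂p y₀∈Y))
    ...     | c∈U , c∈Ny₀ | inj₁ M = inj₁ (matching-extend c∈U c∈Ny₀ M)
    ...     | _           | inj₂ V = contradiction (violator⇒tight y₀∈Y V) no-tight

  -- Discarding a violator Z and its neighbourhood Γ Z keeps |Y| < |U|, and no remaining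
  -- point is adjacent to Z, so a critical pair of the remainder is one of U and Y.
  critical : ∀ U Y → ∣ Y ∣ < ∣ U ∣ → Critical N U Y
  critical U Y = go U Y (⊂-wellFounded Y)
    where
    lift : ∀ {U Y} Z → Critical N (U ─ Γ Z) (Y ─ Z) → Critical N U Y
    lift {U} {Y} Z C = record
      { A        = A
      ; X        = X
      ; A⊆U      = p─q⊆p U (Γ Z) ∘ A⊆U
      ; closed   = closed′
      ; matching = matching
      ; ∣X∣<∣A∣  = ∣X∣<∣A∣
      }
      where
      open Critical C

      closed′ : ∀ {i y} → i ∈ A → y ∈ Y → i ∈ N y → y ∈ X
      closed′ {i} {y} i∈A y∈Y i∈Ny with y ∈? Z
      ... | yes y∈Z = contradiction (x∈⋃⁺ N y∈Z i∈Ny) (x∈p─q⇒x∉q (A⊆U i∈A))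
      ... | no  y∉Z = closed i∈A (x∈p∧x∉q⇒x∈p─q y∈Y y∉Z) i∈Ny

    go : ∀ U Y → Acc _⊂_ Y → ∣ Y ∣ < ∣ U ∣ → Critical N U Y
    go U Y (acc rec) ∣Y∣<∣U∣ with hall U Y
    ... | inj₁ M = record
      { A = U ; X = Y ; A⊆U = id ; closed = λ _ y∈Y _ → y∈Y ; matching = M ; ∣X∣<∣A∣ = ∣Y∣<∣U∣ }
    ... | inj₂ (violator Z Z⊆Y deficient) =
      lift Z (go (U ─ Γ Z) (Y ─ Z) (rec (⊆∧Nonempty⇒p─q⊂p Z⊆Y Z-nonempty)) ∣Y─Z∣<∣U─ΓZ∣)
      where
      Z-nonempty : Nonempty Z
      Z-nonempty = 0<∣p∣⇒Nonempty (≤-<-trans z≤n deficient)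

      ∣U∩ΓZ∣≤∣Y∩Z∣ : ∣ U ∩ Γ Z ∣ ≤ ∣ Y ∩ Z ∣
      ∣U∩ΓZ∣≤∣Y∩Z∣ = ≤-trans (<⇒≤ deficient) (p⊆q⇒∣p∣≤∣q∣ λ y∈Z → x∈p∩q⁺ (Z⊆Y y∈Z , y∈Z))

      ∣Y─Z∣<∣U─ΓZ∣ : ∣ Y ─ Z ∣ < ∣ U ─ Γ Z ∣
      ∣Y─Z∣<∣U─ΓZ∣ = +-cancelˡ-< ∣ Y ∩ Z ∣ _ _ (begin-strict
        ∣ Y ∩ Z ∣ + ∣ Y ─ Z ∣          ≡⟨ ∣p∣≡∣p∩q∣+∣p─q∣ Y Z ⟨
        ∣ Y ∣                          <⟨ ∣Y∣<∣U∣ ⟩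
        ∣ U ∣                          ≡⟨ ∣p∣≡∣p∩q∣+∣p─q∣ U (Γ Z) ⟩
        ∣ U ∩ Γ Z ∣ + ∣ U ─ Γ Z ∣      ≤⟨ +-monoˡ-≤ _ ∣U∩ΓZ∣≤∣Y∩Z∣ ⟩
        ∣ Y ∩ Z ∣ + ∣ U ─ Γ Z ∣        ∎)
        where open ≤-Reasoning

-- Compressing inclusion representations

record Compression {m m′} (F : Fin n → Subset m) (G : Fin n → Subset m′) : Set where
  field
    ⊆⇔⊆     : ∀ x y → F x ⊆ F y ⇔ G x ⊆ G y
    ∣G∣≤∣F∣ : ∀ x → ∣ G x ∣ ≤ ∣ F x ∣

compression-refl : {F : Fin n → Subset m} → Compression F F
compression-refl = record { ⊆⇔⊆ = λ _ _ → ⇔-refl ; ∣G∣≤∣F∣ = λ _ → ≤-refl }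

compression-trans : ∀ {m₁ m₂ m₃} {F : Fin n → Subset m₁} {G : Fin n → Subset m₂}
                    {H : Fin n → Subset m₃} → Compression F G → Compression G H → Compression F H
compression-trans F⇝G G⇝H = record
  { ⊆⇔⊆     = λ x y → ⇔-trans (F⇝G.⊆⇔⊆ x y) (G⇝H.⊆⇔⊆ x y)
  ; ∣G∣≤∣F∣ = λ x → ≤-trans (G⇝H.∣G∣≤∣F∣ x) (F⇝G.∣G∣≤∣F∣ x)
  }
  where
  module F⇝G = Compression F⇝G
  module G⇝H = Compression G⇝H

removeColumn-compression : ∀ (F : Fin n → Subset (suc m)) j → (∀ x → j ∉ F x) →
                           Compression F (λ x → removeAt (F x) j)
removeColumn-compression F j unused = record
  { ⊆⇔⊆     = λ x y → p⊆q⇔removeAt⊆removeAt j (unused x)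
  ; ∣G∣≤∣F∣ = λ x → ∣removeAt∣≤∣p∣ (F x) j
  }

module Rerouting (F : Fin n → Subset m) {A X} (M : Matching F A X)
                 (closed : ∀ {i y} → i ∈ A → i ∈ F y → y ∈ X) where

  open Matching M renaming (match to g)

  below? : ∀ x y → Dec (F y ⊆ F x)
  below? x y = F y ⊆? F x

  ↓ : Fin n → Subset n
  ↓ x = select (below? x)

  rerouted : Fin n → Subset m
  rerouted x = (F x ─ A) ∪ (⋃[ y ∈ X ∩ ↓ x ] ⁅ g y ⁆)

  ∈rerouted⁺ˡ : ∀ {x i} → i ∈ F x → i ∉ A → i ∈ rerouted x
  ∈rerouted⁺ˡ i∈Fx i∉A = x∈p∪q⁺ (inj₁ (x∈p∧x∉q⇒x∈p─q i∈Fx i∉A))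

  ∈rerouted⁺ʳ : ∀ {x y} → y ∈ X → F y ⊆ F x → g y ∈ rerouted x
  ∈rerouted⁺ʳ y∈X Fy⊆Fx =
    x∈p∪q⁺ (inj₂ (x∈⋃⁺ (⁅_⁆ ∘ g) (x∈p∩q⁺ (y∈X , x∈select⁺ (below? _) Fy⊆Fx)) (x∈⁅x⁆ _)))

  ∈rerouted⁻ : ∀ {x i} → i ∈ rerouted x →
               (i ∈ F x × i ∉ A) ⊎ (∃ λ y → y ∈ X × F y ⊆ F x × i ≡ g y)
  ∈rerouted⁻ {x} i∈ with x∈p∪q⁻ (F x ─ A) _ i∈
  ... | inj₁ i∈Fx─A = inj₁ (p─q⊆p (F x) A i∈Fx─A , x∈p─q⇒x∉q i∈Fx─A)
  ... | inj₂ i∈image with x∈⋃⁻ (⁅_⁆ ∘ g) i∈image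
  ...   | y , y∈X∩↓x , i∈⁅gy⁆ with x∈p∩q⁻ X (↓ x) y∈X∩↓x
  ...     | y∈X , y∈↓x = inj₂ (y , y∈X , x∈select⁻ (below? x) y∈↓x , x∈⁅y⁆⇒x≡y (g y) i∈⁅gy⁆)

  rerouted⊆F : ∀ x → rerouted x ⊆ F x
  rerouted⊆F x i∈ with ∈rerouted⁻ i∈
  ... | inj₁ (i∈Fx , _)               = i∈Fx
  ... | inj₂ (y , y∈X , Fy⊆Fx , refl) = Fy⊆Fx (match∈N y∈X)

  rerouted-mono : ∀ x x′ → F x ⊆ F x′ → rerouted x ⊆ rerouted x′
  rerouted-mono x x′ Fx⊆Fx′ i∈ with ∈rerouted⁻ i∈
  ... | inj₁ (i∈Fx , i∉A)             = ∈rerouted⁺ˡ (Fx⊆Fx′ i∈Fx) i∉A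
  ... | inj₂ (y , y∈X , Fy⊆Fx , refl) = ∈rerouted⁺ʳ y∈X (⊆-trans Fy⊆Fx Fx⊆Fx′)

  rerouted-reflects : ∀ x x′ → rerouted x ⊆ rerouted x′ → F x ⊆ F x′
  rerouted-reflects x x′ R⊆ {i} i∈Fx with i ∈? A
  ... | no i∉A with ∈rerouted⁻ (R⊆ (∈rerouted⁺ˡ i∈Fx i∉A))
  ...   | inj₁ (i∈Fx′ , _)          = i∈Fx′
  ...   | inj₂ (y , y∈X , _ , refl) = contradiction (match∈U y∈X) i∉A
  rerouted-reflects x x′ R⊆ {i} i∈Fx | yes i∈A
    with closed i∈A i∈Fx
  ... | x∈X with ∈rerouted⁻ (R⊆ (∈rerouted⁺ʳ x∈X ⊆-refl))
  ...   | inj₁ (_ , gx∉A)                 = contradiction (match∈U x∈X) gx∉A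
  ...   | inj₂ (y , y∈X , Fy⊆Fx′ , gx≡gy) with injective x∈X y∈X gx≡gy
  ...     | refl = Fy⊆Fx′ i∈Fx

  rerouting-compression : Compression F rerouted
  rerouting-compression = record
    { ⊆⇔⊆     = λ x x′ → mk⇔ (rerouted-mono x x′) (rerouted-reflects x x′)
    ; ∣G∣≤∣F∣ = λ x → p⊆q⇒∣p∣≤∣q∣ (rerouted⊆F x)
    }

  rerouted-avoids : ∀ {j} → j ∈ A → j ∉ (⋃[ y ∈ X ] ⁅ g y ⁆) → ∀ x → j ∉ rerouted x
  rerouted-avoids j∈A j∉image x j∈ with ∈rerouted⁻ j∈
  ... | inj₁ (_ , j∉A)              = j∉A j∈A
  ... | inj₂ (y , y∈X , _ , refl) = j∉image (x∈⋃⁺ (⁅_⁆ ∘ g) y∈X (x∈⁅x⁆ _))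

FreeColumn : (F : Fin n → Subset m) → Set
FreeColumn {n} {m} F = ∃ λ j → Σ (Fin n → Subset m) λ G → Compression F G × (∀ x → j ∉ G x)

critical⇒FreeColumn : (F : Fin n → Subset m) → Critical F ⊤ ⊤ → FreeColumn F
critical⇒FreeColumn {m = m} F C =
  let j , j∈A─image = ∣q∣<∣p∣⇒Nonempty[p─q] A image ∣image∣<∣A∣
  in j , rerouted , rerouting-compression ,
     rerouted-avoids (p─q⊆p A image j∈A─image) (x∈p─q⇒x∉q j∈A─image)
  where
  open Critical C
  open Matching matching renaming (match to g)
  open Rerouting F matching (λ i∈A i∈Fy → closed i∈A ∈⊤ i∈Fy)

  image : Subset m
  image = ⋃[ y ∈ X ] ⁅ g y ⁆

  ∣image∣<∣A∣ : ∣ image ∣ < ∣ A ∣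
  ∣image∣<∣A∣ = ≤-<-trans (∣⋃∣≤∣Z∣ (⁅_⁆ ∘ g) X (λ y → ≤-reflexive (∣⁅x⁆∣≡1 (g y)))) ∣X∣<∣A∣

freeColumn : n < m → (F : Fin n → Subset m) → FreeColumn F
freeColumn {n} {suc m} n<m F = critical⇒FreeColumn F (Hall.critical F Fin.zero ⊤ ⊤ ∣⊤∣<∣⊤∣)
  where
  ∣⊤∣<∣⊤∣ : ∣ ⊤ {n} ∣ < ∣ ⊤ {suc m} ∣
  ∣⊤∣<∣⊤∣ = subst₂ _<_ (sym (∣⊤∣≡n n)) (sym (∣⊤∣≡n (suc m))) n<m

CoveringCompression : (F : Fin n → Subset m) → Set
CoveringCompression {n} F =
  ∃ λ m′ → m′ ≤ n × Σ (Fin n → Subset m′) λ G → Compression F G × (∀ i → ∃ λ x → i ∈ G x)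

compression-prepend : {F : Fin n → Subset m} {G : Fin n → Subset m′} →
                      Compression F G → CoveringCompression G → CoveringCompression F
compression-prepend F⇝G (m′ , m′≤n , H , G⇝H , H-covers) =
  m′ , m′≤n , H , compression-trans F⇝G G⇝H , H-covers

¬unused⇒covers : (F : Fin n → Subset m) → ¬ (∃ λ j → ∀ x → j ∉ F x) → ∀ i → ∃ λ x → i ∈ F x
¬unused⇒covers F no-unused i with any? (λ x → i ∈? F x)
... | yes i-used   = i-used
... | no  i-unused = contradiction (i , λ x i∈Fx → i-unused (x , i∈Fx)) no-unused

compress : ∀ m (F : Fin n → Subset m) → CoveringCompression F

dropColumn : ∀ m (F : Fin n → Subset (suc m)) j → (∀ x → j ∉ F x) → CoveringCompression F
dropColumn m F j unused = compression-prepend (removeColumn-compression F j unused) (compress m _)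

compress zero    F = 0 , z≤n , F , compression-refl , λ ()
compress {n} (suc m) F with any? (λ j → all? (λ x → ¬? (j ∈? F x)))
... | yes (j , unused) = dropColumn m F j unused
... | no  no-unused with suc m ≤? n
...   | yes m≤n = suc m , m≤n , F , compression-refl , ¬unused⇒covers F no-unused
...   | no  m≰n =
  let j , G , F⇝G , unused = freeColumn (≰⇒> m≰n) F
  in compression-prepend F⇝G (dropColumn m G j unused)

theorem1p1 : (n : ℕ) → .{{_ : NonZero n}} → (P : FinPoset n) →
    (h w : ℕ) → IsCubeHeight P h → IsCubeWidth P h w → w ≤ n
theorem1p1 n P h w _ ((S , S-rep , _ , S-height) , w-minimal) =
  let w′ , w′≤n , G , S⇝G , G-covers = compress w S
      open Compression S⇝G
      G-rep x y = ⇔-trans (S-rep x y) (⊆⇔⊆ x y)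
      G-height x = ≤-trans (∣G∣≤∣F∣ x) (S-height x)
  in ≤-trans (w-minimal w′ (G , G-rep , G-covers , G-height)) w′≤n
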